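{- Let $\mathcal M$ be a Turing machine that always halts (on every input it eventually reaches an accepting or a rejecting state). Then $L^\omega(\mathcal M)=L(\mathcal M)$.
   Context: A Turing machine over finite alphabet $\Sigma$ (blank $B$) is $(Q,q_0,F,R,\Gamma)$ with finite state set $Q$, initial state $q_0$, disjoint accepting set $F$ and rejecting set $R$ (closed under transitions), and transitions $(q,a)\to(q',b,\delta)$, $\delta\in\{ -1,0,1\}$, on a bi-infinite tape. $L(\mathcal M)$ is the set of words $w$ such that from the initial configuration on $w$ a state in $F$ is reached. For $n>0$, the time $n$-perturbed version of $\mathcal M$ behaves exactly as $\mathcal M$ except that after a time greater than $n$, from any configuration whose state $q\notin F\cup R$, it may nondeterministically change its control state to any $q'\in Q$. $L^n(\mathcal M)$ is the set of words accepted by some run of this perturbed machine, and $L^\omega(\mathcal M)=\bigcap_{n>0}L^n(\mathcal M)$. -}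

module Defs where

open import Data.Nat using (ℕ; zero; suc; _<_)
open import Data.Integer using (ℤ; +_; _+_; -[1+_])
import Data.Integer as ℤ
open import Data.Fin using (Fin)
open import Data.Fin.Subset using (Subset; _∈_; _∉_)
open import Data.List using (List; []; _∷_)
open import Data.Maybe using (Maybe; just; nothing)
open import Data.Product using (Σ; ∃; _×_; _,_)
open import Data.Sum using (_⊎_)
open import Data.Empty using (⊥)
open import Relation.Nullary using (yes; no)
open import Relation.Binary.PropositionalEquality using (_≡_)

data Move : Set where
  left stay right : Move

moveℤ : Move → ℤ
moveℤ left  = -[1+ 0 ]
moveℤ stay  = + 0
moveℤ right = + 1

record TM (nΣ : ℕ) (blank : Fin nΣ) : Set where
  field
    nQ      : ℕ
    q₀      : Fin nQ
    Acc     : Subset nQ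
    Rej     : Subset nQ
    δ       : Fin nQ → Fin nΣ → Maybe (Fin nQ × Fin nΣ × Move)
    disjoint : ∀ q → q ∈ Acc → q ∈ Rej → ⊥
    Acc-closed : ∀ q a q' b d → q ∈ Acc → δ q a ≡ just (q' , b , d) → q' ∈ Acc
    Rej-closed : ∀ q a q' b d → q ∈ Rej → δ q a ≡ just (q' , b , d) → q' ∈ Rej

module _ {nΣ : ℕ} {blank : Fin nΣ} (M : TM nΣ blank) where
  open TM M

  record Config : Set where
    constructor ⟨_,_,_⟩
    field
      state : Fin nQ
      tape  : ℤ → Fin nΣ
      head  : ℤ
  open Config public

  inputTape : List (Fin nΣ) → ℤ → Fin nΣ
  inputTape []      _           = blank
  inputTape (a ∷ w) (+ zero)    = a
  inputTape (a ∷ w) (+ (suc k)) = inputTape w (+ k)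
  inputTape (a ∷ w) -[1+ _ ]    = blank

  initial : List (Fin nΣ) → Config
  initial w = ⟨ q₀ , inputTape w , + 0 ⟩

  write : (ℤ → Fin nΣ) → ℤ → Fin nΣ → ℤ → Fin nΣ
  write t h b j with j ℤ.≟ h
  ... | yes _ = b
  ... | no  _ = t j

  data Step : Config → Config → Set where
    step : ∀ {q t h q' b d} → δ q (t h) ≡ just (q' , b , d) →
           Step ⟨ q , t , h ⟩ ⟨ q' , write t h b , h + moveℤ d ⟩

  data Reach : Config → Config → Set where
    done : ∀ {c} → Reach c c
    more : ∀ {c c' c''} → Step c c' → Reach c' c'' → Reach c c''

  Lang : List (Fin nΣ) → Set
  Lang w = ∃ λ c → Reach (initial w) c × state c ∈ Acc

  AlwaysHalts : Set
  AlwaysHalts = ∀ w → ∃ λ c → Reach (initial w) c × (state c ∈ Acc ⊎ state c ∈ Rej)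

  -- one step of the time n-perturbed machine, taken from a configuration at time t:
  -- either a normal step of M, or (only if t > n and the state is not in F ∪ R)
  -- a change of the control state to an arbitrary q'.
  data PStep (n t : ℕ) : Config → Config → Set where
    normal  : ∀ {c c'} → Step c c' → PStep n t c c'
    perturb : ∀ {q tp h} (q' : Fin nQ) → n < t → q ∉ Acc → q ∉ Rej →
              PStep n t ⟨ q , tp , h ⟩ ⟨ q' , tp , h ⟩

  data PRun (n : ℕ) : ℕ → Config → Config → Set where
    done : ∀ {t c} → PRun n t c c
    more : ∀ {t c c' c''} → PStep n t c c' → PRun n (suc t) c' c'' → PRun n t c c''

  Lang^ : ℕ → List (Fin nΣ) → Set
  Lang^ n w = ∃ λ c → PRun n 0 (initial w) c × state c ∈ Acc

  Lang^ω : List (Fin nΣ) → Set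
  Lang^ω w = ∀ n → 0 < n → Lang^ n w

{-# OPTIONS --safe #-}
-- Before time n the perturbed machine can only make ordinary steps, and M is
-- deterministic, so a perturbed run of the first n steps is a prefix of the
-- unique run of M.  Choosing n longer than M's halting run on w, every
-- perturbed run either stays inside that run or passes through its halting
-- configuration; rejecting states are never left (perturbations are disabled
-- there), so an accepting perturbed run forces M to accept.  Conversely, every
-- run of M is a perturbed run for every n.
module Submission where

open import Defs
open import Data.Nat using (ℕ; suc; _≤_; _+_; s≤s; z≤n)
open import Data.Nat.Properties using (+-suc; m≤m+n; ≤-trans; <⇒≱; n≤1+n)
open import Data.Fin using (Fin)
open import Data.Fin.Subset using (_∈_)
open import Data.List using (List)
open import Data.Product using (_×_; _,_; ∃)
open import Data.Sum using (_⊎_; inj₁; inj₂)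
open import Data.Empty using (⊥-elim)
open import Relation.Binary.PropositionalEquality using (_≡_; refl; sym; trans; subst)

module _ {nΣ : ℕ} {blank : Fin nΣ} (M : TM nΣ blank) where
  open TM M

  length : ∀ {c c'} → Reach M c c' → ℕ
  length done       = 0
  length (more _ r) = suc (length r)

  Step-deterministic : ∀ {c c₁ c₂} → Step M c c₁ → Step M c c₂ → c₁ ≡ c₂
  Step-deterministic (step e₁) (step e₂) with trans (sym e₁) e₂
  ... | refl = refl

  Step-preserves-Rej : ∀ {c c'} → Step M c c' → state c ∈ Rej → state c' ∈ Rej
  Step-preserves-Rej (step {q} {t} {h} {q'} {b} {d} e) r = Rej-closed q (t h) q' b d r e

  PRun-preserves-Rej : ∀ {n t c c'} → PRun M n t c c' → state c ∈ Rej → state c' ∈ Rej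
  PRun-preserves-Rej done                        r = r
  PRun-preserves-Rej (more (normal s) pr)        r = PRun-preserves-Rej pr (Step-preserves-Rej s r)
  PRun-preserves-Rej (more (perturb _ _ _ ∉Rej) _) r = ⊥-elim (∉Rej r)

  Reach⇒PRun : ∀ {n t c c'} → Reach M c c' → PRun M n t c c'
  Reach⇒PRun done       = done
  Reach⇒PRun (more s r) = more (normal s) (Reach⇒PRun r)

  PRun-prefix⊎extension : ∀ {n t c ch c'} (r : Reach M c ch) → t + length r ≤ n →
                          PRun M n t c c' → Reach M c c' ⊎ ∃ λ t' → PRun M n t' ch c'
  PRun-prefix⊎extension     done       _   pr   = inj₂ (_ , pr)
  PRun-prefix⊎extension     (more s r) _   done = inj₁ done
  PRun-prefix⊎extension {n} {t} (more s r) t+∣r∣≤n (more (normal s') pr)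
    with Step-deterministic s s'
  ... | refl with PRun-prefix⊎extension r (subst (_≤ n) (+-suc t (length r)) t+∣r∣≤n) pr
  ...   | inj₁ r'  = inj₁ (more s r')
  ...   | inj₂ ext = inj₂ ext
  PRun-prefix⊎extension {t = t} (more s r) t+∣r∣≤n (more (perturb _ n<t _ _) _) =
    ⊥-elim (<⇒≱ n<t (≤-trans (m≤m+n t _) t+∣r∣≤n))

  halting-PRun-accepts : ∀ {n c ch c'} (r : Reach M c ch) → state ch ∈ Acc ⊎ state ch ∈ Rej →
                         length r ≤ n → PRun M n 0 c c' → state c' ∈ Acc →
                         ∃ λ c'' → Reach M c c'' × state c'' ∈ Acc
  halting-PRun-accepts r halted ∣r∣≤n pr c'∈Acc with PRun-prefix⊎extension r ∣r∣≤n pr | halted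
  ... | inj₁ r'           | _           = _ , r' , c'∈Acc
  ... | inj₂ _            | inj₁ ch∈Acc = _ , r , ch∈Acc
  ... | inj₂ (_ , pr')    | inj₂ ch∈Rej = ⊥-elim (disjoint _ c'∈Acc (PRun-preserves-Rej pr' ch∈Rej))

theorem56 : ∀ {nΣ : ℕ} {blank : Fin nΣ} (M : TM nΣ blank) → AlwaysHalts M →
    ∀ (w : List (Fin nΣ)) → (Lang^ω M w → Lang M w) × (Lang M w → Lang^ω M w)
theorem56 M halts w = Lang^ω⇒Lang , Lang⇒Lang^ω
  where
  Lang^ω⇒Lang : Lang^ω M w → Lang M w
  Lang^ω⇒Lang w∈Lω with halts w
  ... | _ , r , halted with w∈Lω (suc (length M r)) (s≤s z≤n)
  ...   | _ , pr , acc = halting-PRun-accepts M r halted (n≤1+n _) pr acc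

  Lang⇒Lang^ω : Lang M w → Lang^ω M w
  Lang⇒Lang^ω (c , r , acc) _ _ = c , Reach⇒PRun M r , acc
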